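{- Let $G$ be a cobweb with presentation $(C,I)$ and let $\omega$ be a wedge-selection for $(G,C,I)$. If $\{u,v\}\subseteq I$ is a good pair, then each component $P$ of $\omega(u)\cap\omega(v)\cap C$ is separated from $C - V(P)$ in $G$ by $\partial\omega(u) \cup \partial\omega(v)$.
   Context: All graphs are finite and simple. For graphs $G,H$, $G\cap H$ is the graph with vertex set $V(G)\cap V(H)$ and edge set $E(G)\cap E(H)$. A graph $G$ is a cobweb with presentation $(C,I)$ if: $C$ is an induced cycle of $G$ and $I := V(G)\setminus V(C)$ is a non-empty independent set; $G$ has minimum degree at least $2$; and $N(u)\not\subseteq N(v)$ for all distinct $u,v\in I$. A wedge of $(G,C,I)$ is a (not necessarily induced) cycle $W$ containing exactly one vertex $v$ of $I$ (its anchor) and exactly two vertices of $N(v)$; so $W-v$ is a subpath of $C$. $W$ is co-trivial if $V(C)\subseteq V(W)$. Barrier $\partial W$: if $W$ is co-trivial, the two neighbours of the anchor in $W$; otherwise, with $D$ the unique component of $G-V(W)$ containing vertices of $C$, the set of vertices of $C$ adjacent to a vertex of $D$. A wedge-selection $\omega$ assigns to each $v\in I$ a wedge $\omega(v)$ anchored in $v$. $\omega(u)$ improves $\omega(v)$ if $\omega(u)-u$ is a proper subgraph of $\omega(v)-v$; write $u\prec v$ in that case. A vertex of $I$ is good if it is minimal with respect to $\prec$ (no $u$ with $u\prec v$). A good pair is a pair $\{u,v\}$ of not necessarily distinct good vertices. A set $S$ separates $A$ from $B$ if every path from $A$ to $B$ meets $S$. -}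

module Defs where

open import Data.Nat as ℕ using (ℕ; suc; _<?_)
open import Data.Fin using (Fin; zero; suc; toℕ; fromℕ<)
open import Data.Bool using (Bool; true; false)
open import Data.List using (List; []; _∷_)
open import Data.List.Relation.Unary.All using (All)
open import Data.List.Relation.Unary.Any using (Any)
open import Data.List.Relation.Unary.Unique.Propositional using (Unique)
open import Data.Product using (Σ; ∃; ∃-syntax; _×_; _,_)
open import Data.Sum using (_⊎_)
open import Relation.Nullary using (¬_; yes; no)
open import Relation.Binary.PropositionalEquality using (_≡_; _≢_)

record Graph : Set where
  field
    n     : ℕ
    adj   : Fin n → Fin n → Bool
    adj-sym    : ∀ x y → adj x y ≡ adj y x
    adj-irrefl : ∀ x → adj x x ≡ false

next : ∀ {m} → Fin (suc m) → Fin (suc m)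
next {m} i with suc (toℕ i) <? suc m
... | yes p = fromℕ< p
... | no _  = zero

data Walk {A : Set} (E : A → A → Set) : A → A → List A → Set where
  [_] : ∀ x → Walk E x x (x ∷ [])
  _∷_ : ∀ {x y z xs} → E x y → Walk E y z xs → Walk E x z (x ∷ xs)

module _ (G : Graph) where
  open Graph G

  V : Set
  V = Fin n

  _~_ : V → V → Set
  x ~ y = adj x y ≡ true

  record Subgraph : Set₁ where
    field
      VS : V → Set
      ES : V → V → Set

  open Subgraph public

  _⊆G_ : Subgraph → Subgraph → Set
  H ⊆G K = (∀ x → VS H x → VS K x) × (∀ x y → ES H x y → ES K x y)

  _⊂G_ : Subgraph → Subgraph → Set
  H ⊂G K = (H ⊆G K) × ¬ (K ⊆G H)

  _∩G_ : Subgraph → Subgraph → Subgraph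
  H ∩G K = record { VS = λ x → VS H x × VS K x
                  ; ES = λ x y → ES H x y × ES K x y }

  _─_ : Subgraph → V → Subgraph
  H ─ v = record { VS = λ x → VS H x × x ≢ v
                 ; ES = λ x y → ES H x y × x ≢ v × y ≢ v }

  -- a cycle of G (not necessarily induced): distinct vertices
  -- vert 0, ..., vert (len-1), len ≥ 3, consecutive ones (cyclically) adjacent
  record Cycle : Set where
    field
      k    : ℕ
      vert : Fin (suc (suc (suc k))) → V
      vert-inj : ∀ i j → vert i ≡ vert j → i ≡ j
      vert-adj : ∀ i → vert i ~ vert (next i)

  open Cycle public

  ⟪_⟫ : Cycle → Subgraph
  ⟪ W ⟫ = record
    { VS = λ x → ∃[ i ] vert W i ≡ x
    ; ES = λ x y → ∃[ i ] ((vert W i ≡ x × vert W (next i) ≡ y)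
                          ⊎ (vert W i ≡ y × vert W (next i) ≡ x)) }

  Reach : Subgraph → V → V → Set
  Reach H x y = ∃[ ps ] (Walk (ES H) x y ps × All (VS H) ps)

  Separates : (S A B : V → Set) → Set
  Separates S A B = ∀ a b ps → A a → B b → Walk _~_ a b ps → Unique ps → Any S ps

  module Presentation (C : Cycle) where

    InC : V → Set
    InC x = VS ⟪ C ⟫ x

    InI : V → Set
    InI x = ¬ InC x

    record IsCobweb : Set where
      field
        induced     : ∀ x y → InC x → InC y → x ~ y → ES ⟪ C ⟫ x y
        I-nonempty  : ∃[ x ] InI x
        I-indep     : ∀ x y → InI x → InI y → ¬ (x ~ y)
        min-deg-2   : ∀ x → ∃[ y ] ∃[ z ] (y ≢ z × x ~ y × x ~ z)
        nbhd-incomp : ∀ u v → InI u → InI v → u ≢ v → ¬ (∀ w → u ~ w → v ~ w)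

    record IsWedge (v : V) (W : Cycle) : Set where
      field
        anchor-in  : VS ⟪ W ⟫ v
        anchor-I   : InI v
        only-anchor : ∀ x → VS ⟪ W ⟫ x → InI x → x ≡ v
        nb₁ : V
        nb₂ : V
        nb-distinct : nb₁ ≢ nb₂
        nb₁-in : VS ⟪ W ⟫ nb₁ × v ~ nb₁
        nb₂-in : VS ⟪ W ⟫ nb₂ × v ~ nb₂
        only-nbs : ∀ x → VS ⟪ W ⟫ x → v ~ x → x ≡ nb₁ ⊎ x ≡ nb₂

    CoTrivial : Cycle → Set
    CoTrivial W = ∀ x → InC x → VS ⟪ W ⟫ x

    G-minus : Cycle → Subgraph
    G-minus W = record { VS = λ x → ¬ VS ⟪ W ⟫ x
                       ; ES = λ x y → x ~ y }

    -- the vertex set of the component D of G - V(W) containing vertices of C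
    -- (unique when W is a wedge which is not co-trivial)
    InD : Cycle → V → Set
    InD W d = ¬ VS ⟪ W ⟫ d × ∃[ c ] (InC c × Reach (G-minus W) c d)

    Barrier : V → Cycle → V → Set
    Barrier v W x =
        (CoTrivial W × ES ⟪ W ⟫ v x)
      ⊎ (¬ CoTrivial W × InC x × ∃[ d ] (InD W d × x ~ d))

    record WedgeSelection : Set where
      field
        ω : V → Cycle
        ω-wedge : ∀ v → InI v → IsWedge v (ω v)

    module _ (Ω : WedgeSelection) where
      open WedgeSelection Ω

      _≺_ : V → V → Set
      u ≺ v = (⟪ ω u ⟫ ─ u) ⊂G (⟪ ω v ⟫ ─ v)

      Good : V → Set
      Good v = InI v × ¬ (∃[ u ] (InI u × u ≺ v))

module Submission where

-- Each wedge ω(w) minus its anchor w is a path along C, i.e. an arc pos s, pos (s + 1), …,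
-- pos (s + L) of positions on C modulo |C|.  Follow a path from a component P of
-- H = ω(u) ∩ ω(v) ∩ C towards C − V(P) as long as its vertices are reachable from P in H.
-- If the next step a → y runs along C but leaves H, then a is an end of the arc of ω(u) or
-- ω(v), or a has a neighbour on C outside that wedge; either way a lies in a barrier.  If
-- y ∈ I, then a lies in a barrier when y ∈ {u, v} (a is an end of the arc of ω(y)) or when y
-- has a neighbour outside ω(u) or ω(v) (y then lies in the component D).  Otherwise ω(u) and
-- ω(v) contain every neighbour of y, and the goodness of u and v forces both of them to
-- contain the complementary arc of ω(y), which joins a to the vertex after y inside H.

open import Data.Bool as Bool using (Bool; true; false)
open import Data.Empty using (⊥; ⊥-elim)
open import Data.Fin as Fin using (Fin; toℕ)
open import Data.Fin.Properties using (toℕ-fromℕ<; toℕ-injective; toℕ<n; any?)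
open import Data.List.Relation.Unary.All using (All; []; _∷_)
open import Data.List.Relation.Unary.Any using (Any; here; there)
open import Data.Nat
open import Data.Nat.DivMod
open import Data.Nat.Properties
open import Data.Nat.Solver using (module +-*-Solver)
open import Data.Product using (∃-syntax; _×_; _,_; proj₁; proj₂)
open import Data.Sum using (_⊎_; inj₁; inj₂)
open import Relation.Binary.Bundles using (Setoid)
import Relation.Binary.Reasoning.Setoid as SetoidReasoning
open import Relation.Binary.PropositionalEquality
open import Relation.Nullary using (¬_; Dec; yes; no)
open import Relation.Nullary.Decidable using (decidable-stable; _×-dec_; _⊎-dec_; ¬?)
open import Defs

-- Arithmetic modulo m

module Modulo (m : ℕ) .{{_ : NonZero m}} where

  infix 4 _≋_
  record _≋_ (a b : ℕ) : Set where
    constructor mod-eq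
    field %-≡ : a % m ≡ b % m

  ≡⇒≋ : ∀ {a b} → a ≡ b → a ≋ b
  ≡⇒≋ refl = mod-eq refl

  ≋-sym : ∀ {a b} → a ≋ b → b ≋ a
  ≋-sym (mod-eq e) = mod-eq (sym e)

  ≋-trans : ∀ {a b c} → a ≋ b → b ≋ c → a ≋ c
  ≋-trans (mod-eq e) (mod-eq f) = mod-eq (trans e f)

  ≋-setoid : Setoid _ _
  ≋-setoid = record
    { Carrier = ℕ ; _≈_ = _≋_
    ; isEquivalence = record { refl = ≡⇒≋ refl ; sym = ≋-sym ; trans = ≋-trans } }

  module ≋-Reasoning = SetoidReasoning ≋-setoid

  %-≋ : ∀ a → a % m ≋ a
  %-≋ a = mod-eq (m%n%n≡m%n a m)

  +-congˡ-≋ : ∀ c {a b} → a ≋ b → c + a ≋ c + b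
  +-congˡ-≋ c {a} {b} (mod-eq e) = mod-eq (begin
    (c + a) % m           ≡⟨ %-distribˡ-+ c a m ⟩
    (c % m + a % m) % m   ≡⟨ cong (λ z → (c % m + z) % m) e ⟩
    (c % m + b % m) % m   ≡⟨ %-distribˡ-+ c b m ⟨
    (c + b) % m           ∎)
    where open ≡-Reasoning

  +-congʳ-≋ : ∀ c {a b} → a ≋ b → a + c ≋ b + c
  +-congʳ-≋ c {a} {b} e = subst₂ _≋_ (+-comm c a) (+-comm c b) (+-congˡ-≋ c e)

  a+m≋a : ∀ a → a + m ≋ a
  a+m≋a a = mod-eq ([m+n]%n≡m%n a m)

  a+k*m≋a : ∀ a k → a + k * m ≋ a
  a+k*m≋a a k = mod-eq ([m+kn]%n≡m%n a k m)

  ≋-<⇒≡ : ∀ {a b} → a < m → b < m → a ≋ b → a ≡ b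
  ≋-<⇒≡ a<m b<m (mod-eq e) = trans (sym (m<n⇒m%n≡m a<m)) (trans e (m<n⇒m%n≡m b<m))

  offset : ∀ a b → ∃[ r ] (r < m × b + r ≋ a)
  offset a b = r , m%n<n (m ∸ b % m + a) m , b+r≋a
    where
    open ≋-Reasoning
    r = (m ∸ b % m + a) % m
    b+r≋a : b + r ≋ a
    b+r≋a = begin
      b + r                     ≈⟨ +-congʳ-≋ r (≋-sym (%-≋ b)) ⟩
      b % m + r                 ≈⟨ +-congˡ-≋ (b % m) (%-≋ (m ∸ b % m + a)) ⟩
      b % m + (m ∸ b % m + a)   ≡⟨ +-assoc (b % m) (m ∸ b % m) a ⟨
      b % m + (m ∸ b % m) + a   ≡⟨ cong (_+ a) (m+[n∸m]≡n (<⇒≤ (m%n<n b m))) ⟩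
      m + a                     ≡⟨ +-comm m a ⟩
      a + m                     ≈⟨ a+m≋a a ⟩
      a                         ∎

  +-cancelˡ-≋ : ∀ c {a b} → c + a ≋ c + b → a ≋ b
  +-cancelˡ-≋ c {a} {b} e with offset 0 c
  ... | r , _ , c+r≋0 = ≋-trans (≋-sym (undo a)) (≋-trans (+-congˡ-≋ r e) (undo b))
    where
    undo : ∀ x → r + (c + x) ≋ x
    undo x = ≋-trans (≡⇒≋ (trans (sym (+-assoc r c x)) (cong (_+ x) (+-comm r c))))
                     (+-congʳ-≋ x c+r≋0)

  ≋-<2m : ∀ {x c} → x < m + m → c < m → x ≋ c → x ≡ c ⊎ x ≡ c + m
  ≋-<2m {x} {c} x<2m c<m x≋c with x <? m
  ... | yes x<m = inj₁ (≋-<⇒≡ x<m c<m x≋c)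
  ... | no x≮m = inj₂ (begin
    x             ≡⟨ m∸n+n≡m m≤x ⟨
    x ∸ m + m     ≡⟨ cong (_+ m) (≋-<⇒≡ x∸m<m c<m x∸m≋c) ⟩
    c + m         ∎)
    where
    open ≡-Reasoning
    m≤x : m ≤ x
    m≤x = ≮⇒≥ x≮m
    x∸m<m : x ∸ m < m
    x∸m<m = +-cancelʳ-< m (x ∸ m) m (subst (_< m + m) (sym (m∸n+n≡m m≤x)) x<2m)
    x∸m≋c : x ∸ m ≋ c
    x∸m≋c = ≋-trans (≋-sym (a+m≋a (x ∸ m))) (≋-trans (≡⇒≋ (m∸n+n≡m m≤x)) x≋c)

module CyclicIndexing {A : Set} {n : ℕ} (f : Fin (suc n) → A) where
  open Modulo (suc n) public

  at : ℕ → A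
  at a = f (a mod suc n)

  at-cong : ∀ {a b} → a ≋ b → at a ≡ at b
  at-cong {a} {b} (mod-eq e) = cong f (toℕ-injective (begin
    toℕ (a mod suc n) ≡⟨ toℕ-fromℕ< (m%n<n a (suc n)) ⟩
    a % suc n         ≡⟨ e ⟩
    b % suc n         ≡⟨ toℕ-fromℕ< (m%n<n b (suc n)) ⟨
    toℕ (b mod suc n) ∎))
    where open ≡-Reasoning

  at-toℕ : ∀ i → at (toℕ i) ≡ f i
  at-toℕ i = cong f (toℕ-injective (trans (toℕ-fromℕ< (m%n<n (toℕ i) (suc n))) (m<n⇒m%n≡m (toℕ<n i))))

  at-injective : (∀ i j → f i ≡ f j → i ≡ j) → ∀ {a b} → at a ≡ at b → a ≋ b
  at-injective f-inj {a} {b} e = mod-eq (begin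
    a % suc n         ≡⟨ toℕ-fromℕ< (m%n<n a (suc n)) ⟨
    toℕ (a mod suc n) ≡⟨ cong toℕ (f-inj _ _ e) ⟩
    toℕ (b mod suc n) ≡⟨ toℕ-fromℕ< (m%n<n b (suc n)) ⟩
    b % suc n         ∎)
    where open ≡-Reasoning

  toℕ-next : (i : Fin (suc n)) → toℕ (next i) ≡ suc (toℕ i) % suc n
  toℕ-next i with suc (toℕ i) <? suc n
  ... | yes i+1<m = trans (toℕ-fromℕ< i+1<m) (sym (m<n⇒m%n≡m i+1<m))
  ... | no i+1≮m = sym (trans (cong (_% suc n) (≤∧≮⇒≡ (toℕ<n i) i+1≮m)) (n%n≡0 (suc n)))

  f-next : ∀ i → f (next i) ≡ at (suc (toℕ i))
  f-next i = trans (sym (at-toℕ (next i)))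
                   (at-cong {toℕ (next i)} {suc (toℕ i)}
                            (mod-eq (trans (cong (_% suc n) (toℕ-next i)) (m%n%n≡m%n (suc (toℕ i)) (suc n)))))

  f-next-mod : ∀ a → f (next (a mod suc n)) ≡ at (suc a)
  f-next-mod a = trans (f-next (a mod suc n))
                       (at-cong (+-congˡ-≋ 1 (≋-trans (≡⇒≋ (toℕ-fromℕ< (m%n<n a (suc n)))) (%-≋ a))))

  f-from : ∀ j i → ∃[ t ] (t < suc n × f i ≡ at (j + t) × f (next i) ≡ at (j + suc t))
  f-from j i with offset (toℕ i) j
  ... | t , t<m , j+t≋i =
    t , t<m , trans (sym (at-toℕ i)) (at-cong (≋-sym j+t≋i)) ,
    trans (f-next i) (at-cong (≋-trans (+-congˡ-≋ 1 (≋-sym j+t≋i)) (≡⇒≋ (sym (+-suc j t)))))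

orient : Bool → ℕ → ℕ → ℕ
orient false L t = t
orient true  L t = L ∸ t

module _ {L : ℕ} where

  orient-≤ : ∀ b {t} → t ≤ L → orient b L t ≤ L
  orient-≤ false     t≤L = t≤L
  orient-≤ true  {t} _   = m∸n≤m L t

  orient-involutive : ∀ b {t} → t ≤ L → orient b L (orient b L t) ≡ t
  orient-involutive false _   = refl
  orient-involutive true  t≤L = m∸[m∸n]≡n t≤L

  orient-suc : ∀ b {t} → t < L →
               orient b L (suc t) ≡ suc (orient b L t) ⊎ orient b L t ≡ suc (orient b L (suc t))
  orient-suc false _   = inj₁ refl
  orient-suc true  t<L = inj₂ (+-∸-assoc 1 t<L)

  orient-ends : ∀ b → (orient b L 0 ≡ 0 × orient b L L ≡ L) ⊎ (orient b L 0 ≡ L × orient b L L ≡ 0)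
  orient-ends false = inj₁ (refl , refl)
  orient-ends true  = inj₂ (refl , n∸n≡0 L)

  orient-step⇐ : ∀ b {j} → j < L →
                 ∃[ t ] (t < L × ((orient b L t ≡ j × orient b L (suc t) ≡ suc j)
                                ⊎ (orient b L (suc t) ≡ j × orient b L t ≡ suc j)))
  orient-step⇐ false {j} j<L = j , j<L , inj₁ (refl , refl)
  orient-step⇐ true  {j} j<L = L ∸ suc j , t<L , inj₂ (L∸[1+t]≡j , L∸t≡1+j)
    where
    t<L : L ∸ suc j < L
    t<L = ∸-monoʳ-< z<s j<L
    L∸t≡1+j : L ∸ (L ∸ suc j) ≡ suc j
    L∸t≡1+j = m∸[m∸n]≡n j<L
    L∸[1+t]≡j : L ∸ suc (L ∸ suc j) ≡ j
    L∸[1+t]≡j = suc-injective (trans (sym (+-∸-assoc 1 t<L)) L∸t≡1+j)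

module _ {A : Set} {E : A → A → Set} {P : A → Set} where

  All-walk-head : ∀ {x y ps} → Walk E x y ps → All P ps → P x
  All-walk-head [ x ]   (px ∷ _) = px
  All-walk-head (_ ∷ _) (px ∷ _) = px

  All-walk-last : ∀ {x y ps} → Walk E x y ps → All P ps → P y
  All-walk-last [ x ]   (py ∷ []) = py
  All-walk-last (_ ∷ w) (_ ∷ ps) = All-walk-last w ps

  walk-++ : ∀ {x y z ps qs} → Walk E x y ps → All P ps → Walk E y z qs → All P qs →
            ∃[ rs ] (Walk E x z rs × All P rs)
  walk-++ [ x ]   _         w′ pw′ = _ , w′ , pw′
  walk-++ (e ∷ w) (px ∷ pw) w′ pw′ with walk-++ w pw w′ pw′
  ... | _ , w″ , pw″ = _ , e ∷ w″ , px ∷ pw″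

module _ {G : Graph} {H : Subgraph G} where

  reach-refl : ∀ {x} → VS H x → Reach G H x x
  reach-refl {x} x∈H = _ , [ x ] , x∈H ∷ []

  reach-source : ∀ {x y} → Reach G H x y → VS H x
  reach-source (_ , w , pw) = All-walk-head w pw

  reach-target : ∀ {x y} → Reach G H x y → VS H y
  reach-target (_ , w , pw) = All-walk-last w pw

  reach-trans : ∀ {x y z} → Reach G H x y → Reach G H y z → Reach G H x z
  reach-trans (_ , w , pw) (_ , w′ , pw′) = walk-++ w pw w′ pw′

  reach-snoc : ∀ {x y z} → Reach G H x y → ES H y z → VS H z → Reach G H x z
  reach-snoc r e z∈H = reach-trans r (_ , e ∷ [ _ ] , reach-target r ∷ z∈H ∷ [])

  reach-sym : (∀ {x y} → ES H x y → ES H y x) → ∀ {x y} → Reach G H x y → Reach G H y x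
  reach-sym ES-sym (_ , w , pw) = reverse w pw
    where
    reverse : ∀ {x y ps} → Walk (ES H) x y ps → All (VS H) ps → Reach G H y x
    reverse [ _ ]   (px ∷ []) = reach-refl px
    reverse (e ∷ w) (px ∷ pw) = reach-snoc (reverse w pw) (ES-sym e) px

Joins : {A : Set} → A → A → A → A → Set
Joins p q x y = (p ≡ x × q ≡ y) ⊎ (p ≡ y × q ≡ x)

Joins-sym : {A : Set} {p q x y : A} → Joins p q x y → Joins p q y x
Joins-sym (inj₁ e) = inj₂ e
Joins-sym (inj₂ e) = inj₁ e

Joins-trans : {A : Set} {p q a b x y : A} → Joins p q a b → Joins a b x y → Joins p q x y
Joins-trans (inj₁ (refl , refl)) j                     = j
Joins-trans (inj₂ (refl , refl)) (inj₁ (refl , refl)) = inj₂ (refl , refl)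
Joins-trans (inj₂ (refl , refl)) (inj₂ (refl , refl)) = inj₁ (refl , refl)

Joins-≢ : {A : Set} {p q x y w : A} → Joins p q x y → x ≢ w → y ≢ w → p ≢ w × q ≢ w
Joins-≢ (inj₁ (refl , refl)) x≢w y≢w = x≢w , y≢w
Joins-≢ (inj₂ (refl , refl)) x≢w y≢w = y≢w , x≢w

one-of-two : {A : Set} {P : A → Set} {n₁ n₂ a b : A} → (∀ x → P x → x ≡ n₁ ⊎ x ≡ n₂) →
             a ≢ b → P a → P b → ∀ {x} → P x → x ≡ a ⊎ x ≡ b
one-of-two {n₁ = n₁} {n₂} {a} {b} only a≢b pa pb {x} px = go (only x px) (only a pa) (only b pb)
  where
  go : x ≡ n₁ ⊎ x ≡ n₂ → a ≡ n₁ ⊎ a ≡ n₂ → b ≡ n₁ ⊎ b ≡ n₂ → x ≡ a ⊎ x ≡ b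
  go (inj₁ refl) (inj₁ refl) _           = inj₁ refl
  go (inj₁ refl) (inj₂ refl) (inj₁ refl) = inj₂ refl
  go (inj₁ refl) (inj₂ refl) (inj₂ refl) = ⊥-elim (a≢b refl)
  go (inj₂ refl) (inj₂ refl) _           = inj₁ refl
  go (inj₂ refl) (inj₁ refl) (inj₂ refl) = inj₂ refl
  go (inj₂ refl) (inj₁ refl) (inj₁ refl) = ⊥-elim (a≢b refl)

module Cobweb (G : Graph) (C : Cycle G) (cob : Presentation.IsCobweb G C) where
  open Graph G
  open Presentation G C
  open IsCobweb cob

  infix 4 _∼_
  _∼_ : V G → V G → Set
  _∼_ = _~_ G

  ⟦_⟧ : Cycle G → Subgraph G
  ⟦_⟧ = ⟪_⟫ G

  ∼-sym : ∀ {x y} → x ∼ y → y ∼ x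
  ∼-sym {x} {y} x∼y = trans (adj-sym y x) x∼y

  _∼?_ : ∀ x y → Dec (x ∼ y)
  x ∼? y = adj x y Bool.≟ true

  ∈? : ∀ W x → Dec (VS ⟦ W ⟧ x)
  ∈? W x = any? (λ i → vert W i Fin.≟ x)

  InC? : ∀ x → Dec (InC x)
  InC? = ∈? C

  ES? : ∀ W x y → Dec (ES ⟦ W ⟧ x y)
  ES? W x y = any? λ i → let p = vert W i ; q = vert W (next i) in
    ((p Fin.≟ x) ×-dec (q Fin.≟ y)) ⊎-dec ((p Fin.≟ y) ×-dec (q Fin.≟ x))

  ES-sym : ∀ {W x y} → ES ⟦ W ⟧ x y → ES ⟦ W ⟧ y x
  ES-sym (i , j) = i , Joins-sym j

  ES⇒∼ : ∀ {W x y} → ES ⟦ W ⟧ x y → x ∼ y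
  ES⇒∼ {W} (i , inj₁ (refl , refl)) = vert-adj W i
  ES⇒∼ {W} (i , inj₂ (refl , refl)) = ∼-sym (vert-adj W i)

  ES⇒VSʳ : ∀ {W x y} → ES ⟦ W ⟧ x y → VS ⟦ W ⟧ y
  ES⇒VSʳ {W} (i , inj₁ (_ , e)) = next i , e
  ES⇒VSʳ {W} (i , inj₂ (e , _)) = i , e

  ¬InI⇒InC : ∀ {x} → ¬ InI x → InC x
  ¬InI⇒InC {x} = decidable-stable (InC? x)

  I-nbr⇒InC : ∀ {x y} → InI y → x ∼ y → InC x
  I-nbr⇒InC {x} {y} y∈I x∼y = ¬InI⇒InC (λ x∈I → I-indep x y x∈I y∈I x∼y)

  InC⇒≢InI : ∀ {x y} → InC x → InI y → x ≢ y
  InC⇒≢InI x∈C y∈I refl = y∈I x∈C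

  nbrs-inside-or-escape : ∀ W y → (∀ c → c ∼ y → VS ⟦ W ⟧ c) ⊎ ∃[ c ] (c ∼ y × ¬ VS ⟦ W ⟧ c)
  nbrs-inside-or-escape W y with any? (λ c → (c ∼? y) ×-dec ¬? (∈? W c))
  ... | yes (c , c∼y , c∉W) = inj₂ (c , c∼y , c∉W)
  ... | no ¬escape = inj₁ (λ c c∼y → decidable-stable (∈? W c) (λ c∉W → ¬escape (c , c∼y , c∉W)))

  -- pos a is the vertex at position a mod m on C, so adding m′ = m ∸ 1 steps back by one.
  m′ : ℕ
  m′ = suc (suc (k C))

  m : ℕ
  m = suc m′

  open CyclicIndexing (vert C) public
    using (_≋_; mod-eq; ≡⇒≋; ≋-sym; ≋-trans; module ≋-Reasoning; %-≋; +-congˡ-≋; +-congʳ-≋;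
           a+m≋a; a+k*m≋a; ≋-<⇒≡; offset; +-cancelˡ-≋; ≋-<2m)
    renaming (at to pos; at-cong to pos-cong; at-toℕ to pos-toℕ;
              f-next to vert-next; f-next-mod to vert-next-mod)

  pos-injective : ∀ {a b} → pos a ≡ pos b → a ≋ b
  pos-injective = CyclicIndexing.at-injective (vert C) (vert-inj C)

  pos-InC : ∀ a → InC (pos a)
  pos-InC a = a mod m , refl

  InC⇒pos : ∀ {x} → InC x → ∃[ a ] (x ≡ pos a)
  InC⇒pos (i , refl) = toℕ i , sym (pos-toℕ i)

  pos-ES : ∀ a → ES ⟦ C ⟧ (pos a) (pos (suc a))
  pos-ES a = a mod m , inj₁ (refl , vert-next-mod a)

  pos-adj : ∀ a → pos a ∼ pos (suc a)
  pos-adj a = ES⇒∼ {C} (pos-ES a)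

  suc≋⇒≋+m′ : ∀ a b → suc a ≋ b → a ≋ b + m′
  suc≋⇒≋+m′ a b 1+a≋b = begin
    a           ≈⟨ a+m≋a a ⟨
    a + m       ≡⟨ +-suc a m′ ⟩
    suc a + m′  ≈⟨ +-congʳ-≋ m′ 1+a≋b ⟩
    b + m′      ∎
    where open ≋-Reasoning

  pos-pred-adj : ∀ a → pos (a + m′) ∼ pos a
  pos-pred-adj a = subst (pos (a + m′) ∼_) (pos-cong (≋-trans (≡⇒≋ (sym (+-suc a m′))) (a+m≋a a)))
                         (pos-adj (a + m′))

  C-nbr : ∀ a {y} → InC y → pos a ∼ y → y ≡ pos (suc a) ⊎ y ≡ pos (a + m′)
  C-nbr a {y} y∈C a∼y with induced (pos a) y (pos-InC a) y∈C a∼y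
  ... | i , inj₁ (i≡a , refl) = inj₁ (trans (vert-next i) (pos-cong (+-congˡ-≋ 1 i≋a)))
    where
    i≋a : toℕ i ≋ a
    i≋a = pos-injective (trans (pos-toℕ i) i≡a)
  ... | i , inj₂ (refl , next-i≡a) =
    inj₂ (trans (sym (pos-toℕ i)) (pos-cong (suc≋⇒≋+m′ (toℕ i) a 1+i≋a)))
    where
    1+i≋a : suc (toℕ i) ≋ a
    1+i≋a = pos-injective (trans (sym (vert-next i)) next-i≡a)

  -- Wedges as arcs of C

  record Arc (w : V G) (W : Cycle G) : Set where
    field
      s L         : ℕ
      L<m         : L < m
      vertex⇒     : ∀ x → VS ⟦ W ⟧ x → x ≢ w → ∃[ j ] (j ≤ L × x ≡ pos (s + j))
      vertex⇐     : ∀ j → j ≤ L → VS ⟦ W ⟧ (pos (s + j))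
      edge⇒       : ∀ x y → ES ⟦ W ⟧ x y → x ≢ w → y ≢ w →
                    ∃[ j ] (j < L × Joins (pos (s + j)) (pos (suc (s + j))) x y)
      edge⇐       : ∀ j → j < L → ES ⟦ W ⟧ (pos (s + j)) (pos (suc (s + j)))
      first-edge  : ES ⟦ W ⟧ w (pos s)
      last-edge   : ES ⟦ W ⟧ w (pos (s + L))
      anchor-nbrs : ∀ x → VS ⟦ W ⟧ x → w ∼ x → x ≡ pos s ⊎ x ≡ pos (s + L)

  module WedgeArc {w : V G} {W : Cycle G} (wedge : IsWedge w W) where
    open IsWedge wedge

    L : ℕ
    L = suc (k W)

    module R = CyclicIndexing (vert W)

    j₀ : ℕ
    j₀ = toℕ (proj₁ anchor-in)

    tour : ℕ → V G
    tour t = R.at (j₀ + t)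

    tour-0 : tour 0 ≡ w
    tour-0 = trans (cong R.at (+-identityʳ j₀)) (trans (R.at-toℕ _) (proj₂ anchor-in))

    tour-closes : tour (suc (suc L)) ≡ w
    tour-closes = trans (R.at-cong (R.≋-trans (R.a+m≋a j₀) (R.≡⇒≋ (sym (+-identityʳ j₀))))) tour-0

    tour-injective : ∀ {t t′} → t < suc (suc L) → t′ < suc (suc L) → tour t ≡ tour t′ → t ≡ t′
    tour-injective t< t′< e = R.≋-<⇒≡ t< t′< (R.+-cancelˡ-≋ j₀ (R.at-injective (vert-inj W) e))

    tour-VS : ∀ t → VS ⟦ W ⟧ (tour t)
    tour-VS t = _ , refl

    tour-ES : ∀ t → ES ⟦ W ⟧ (tour t) (tour (suc t))
    tour-ES t = _ , inj₁ (refl , trans (R.f-next-mod (j₀ + t)) (cong R.at (sym (+-suc j₀ t))))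

    tour-adj : ∀ t → tour t ∼ tour (suc t)
    tour-adj t = ES⇒∼ {W} (tour-ES t)

    VS⇒tour : ∀ x → VS ⟦ W ⟧ x → ∃[ t ] (t < suc (suc L) × x ≡ tour t)
    VS⇒tour x (i , refl) with R.f-from j₀ i
    ... | t , t< , e , _ = t , t< , e

    ES⇒tour : ∀ x y → ES ⟦ W ⟧ x y → ∃[ t ] (t < suc (suc L) × Joins (tour t) (tour (suc t)) x y)
    ES⇒tour x y (i , j) with R.f-from j₀ i
    ... | t , t< , e , e′ = t , t< , subst₂ (λ p q → Joins p q x y) e e′ j

    tour-InC : ∀ t → t < suc (suc L) → t ≢ 0 → InC (tour t)
    tour-InC t t< t≢0 = ¬InI⇒InC λ t∈I →
      t≢0 (tour-injective t< z<s (trans (only-anchor (tour t) (tour-VS t) t∈I) (sym tour-0)))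

    record Oriented : Set where
      field
        s        : ℕ
        reversed : Bool
        L<m      : L < m
        tour-pos : ∀ t → t ≤ L → tour (suc t) ≡ pos (s + orient reversed L t)

    -- The tour cannot step back onto the vertex it has just left, so it keeps moving by δ.
    module Steady (a₁ δ δ̄ : ℕ) (δ+δ̄≡m : δ + δ̄ ≡ m)
                  (C-nbr′ : ∀ a {y} → InC y → pos a ∼ y → y ≡ pos (a + δ) ⊎ y ≡ pos (a + δ̄))
                  (tour-1 : tour 1 ≡ pos a₁) (tour-2 : tour 2 ≡ pos (a₁ + δ)) where
      open +-*-Solver

      tour-pairs : ∀ t → 2 + t ≤ suc L →
                   tour (1 + t) ≡ pos (a₁ + t * δ) × tour (2 + t) ≡ pos (a₁ + suc t * δ)
      tour-pairs zero    _    = trans tour-1 (cong pos (sym (+-identityʳ a₁))) ,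
                                trans tour-2 (cong (λ z → pos (a₁ + z)) (sym (+-identityʳ δ)))
      tour-pairs (suc t) 3+t≤ =
        proj₂ previous ,
        keeps-going (C-nbr′ (a₁ + suc t * δ) (tour-InC (3 + t) (s≤s 3+t≤) λ ())
                            (subst (_∼ tour (3 + t)) (proj₂ previous) (tour-adj (2 + t))))
        where
        previous : tour (1 + t) ≡ pos (a₁ + t * δ) × tour (2 + t) ≡ pos (a₁ + suc t * δ)
        previous = tour-pairs t (≤-trans (n≤1+n (2 + t)) 3+t≤)
        step-back : a₁ + suc t * δ + δ̄ ≋ a₁ + t * δ
        step-back = begin
          a₁ + suc t * δ + δ̄    ≡⟨ solve 4 (λ a t d d̄ → a :+ (con 1 :+ t) :* d :+ d̄
                                                      := (a :+ t :* d) :+ (d :+ d̄))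
                                          refl a₁ t δ δ̄ ⟩
          a₁ + t * δ + (δ + δ̄)  ≡⟨ cong (a₁ + t * δ +_) δ+δ̄≡m ⟩
          a₁ + t * δ + m        ≈⟨ a+m≋a (a₁ + t * δ) ⟩
          a₁ + t * δ            ∎
          where open ≋-Reasoning
        keeps-going : tour (3 + t) ≡ pos (a₁ + suc t * δ + δ) ⊎ tour (3 + t) ≡ pos (a₁ + suc t * δ + δ̄) →
                      tour (3 + t) ≡ pos (a₁ + suc (suc t) * δ)
        keeps-going (inj₁ e) = trans e (cong pos
          (solve 3 (λ a t d → a :+ (con 1 :+ t) :* d :+ d := a :+ (con 2 :+ t) :* d) refl a₁ t δ))
        keeps-going (inj₂ e) = ⊥-elim (<⇒≢ (n≤1+n (2 + t)) (sym 3+t≡1+t))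
          where
          3+t≡1+t : 3 + t ≡ 1 + t
          3+t≡1+t = tour-injective (s≤s 3+t≤) (s≤s (≤-trans (m≤n+m (1 + t) 2) 3+t≤))
                                   (trans e (trans (pos-cong step-back) (sym (proj₁ previous))))

      tour-pos : ∀ t → t ≤ L → tour (suc t) ≡ pos (a₁ + t * δ)
      tour-pos zero    _   = proj₁ (tour-pairs 0 (s≤s (s≤s z≤n)))
      tour-pos (suc t) t<L = proj₂ (tour-pairs t (s≤s t<L))

      L<m : L < m
      L<m with L <? m
      ... | yes L<m = L<m
      ... | no  L≮m =
        ⊥-elim (1+m≢1 (tour-injective (s≤s (s≤s m≤L)) (s≤s z<s) (trans (tour-pos m m≤L) m-th≡first)))
        where
        m≤L : m ≤ L
        m≤L = ≮⇒≥ L≮m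
        m-th≡first : pos (a₁ + m * δ) ≡ tour 1
        m-th≡first =
          trans (pos-cong (≋-trans (≡⇒≋ (cong (a₁ +_) (*-comm m δ))) (a+k*m≋a a₁ δ))) (sym tour-1)
        1+m≢1 : suc m ≢ 1
        1+m≢1 ()

    forward : ∀ a₁ → tour 1 ≡ pos a₁ → tour 2 ≡ pos (suc a₁) → Oriented
    forward a₁ tour-1 tour-2 = record
      { s = a₁ ; reversed = false ; L<m = S.L<m
      ; tour-pos = λ t t≤L → trans (S.tour-pos t t≤L) (cong (λ z → pos (a₁ + z)) (*-identityʳ t)) }
      where
      C-nbr⁺ : ∀ a {y} → InC y → pos a ∼ y → y ≡ pos (a + 1) ⊎ y ≡ pos (a + m′)
      C-nbr⁺ a y∈C a∼y with C-nbr a y∈C a∼y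
      ... | inj₁ e = inj₁ (trans e (cong pos (+-comm 1 a)))
      ... | inj₂ e = inj₂ e
      module S = Steady a₁ 1 m′ refl C-nbr⁺ tour-1 (trans tour-2 (cong pos (+-comm 1 a₁)))

    -- Backwards, a₁ + t * m′ ≋ a₁ − t, so the arc starts at a₁ − L ≋ a₁ + L * m′.
    backward : ∀ a₁ → tour 1 ≡ pos a₁ → tour 2 ≡ pos (a₁ + m′) → Oriented
    backward a₁ tour-1 tour-2 = record
      { s = a₁ + L * m′ ; reversed = true ; L<m = S.L<m ; tour-pos = tour-pos }
      where
      open +-*-Solver
      C-nbr⁻ : ∀ a {y} → InC y → pos a ∼ y → y ≡ pos (a + m′) ⊎ y ≡ pos (a + 1)
      C-nbr⁻ a y∈C a∼y with C-nbr a y∈C a∼y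
      ... | inj₁ e = inj₂ (trans e (cong pos (+-comm 1 a)))
      ... | inj₂ e = inj₁ e
      module S = Steady a₁ m′ 1 (+-comm m′ 1) C-nbr⁻ tour-1 tour-2
      tour-pos : ∀ t → t ≤ L → tour (suc t) ≡ pos (a₁ + L * m′ + (L ∸ t))
      tour-pos t t≤L = trans (S.tour-pos t t≤L) (pos-cong (begin
        a₁ + t * m′                          ≈⟨ a+k*m≋a (a₁ + t * m′) (L ∸ t) ⟨
        a₁ + t * m′ + (L ∸ t) * m            ≡⟨ solve 4 (λ a t e q → a :+ (t :+ e) :* q :+ e
                                                                   := (a :+ t :* q) :+ e :* (con 1 :+ q))
                                                        refl a₁ t (L ∸ t) m′ ⟨
        a₁ + (t + (L ∸ t)) * m′ + (L ∸ t)    ≡⟨ cong (λ z → a₁ + z * m′ + (L ∸ t))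
                                                        (m+[n∸m]≡n t≤L) ⟩
        a₁ + L * m′ + (L ∸ t)                ∎))
        where open ≋-Reasoning

    oriented : Oriented
    oriented = from-start (InC⇒pos (tour-InC 1 (s≤s z<s) λ ()))
      where
      from-start : ∃[ a₁ ] (tour 1 ≡ pos a₁) → Oriented
      from-start (a₁ , tour-1)
        with C-nbr a₁ (tour-InC 2 (s≤s (s≤s z<s)) λ ()) (subst (_∼ tour 2) tour-1 (tour-adj 1))
      ... | inj₁ tour-2 = forward a₁ tour-1 tour-2
      ... | inj₂ tour-2 = backward a₁ tour-1 tour-2

    module FromOrientation (o : Oriented) where
      open Oriented o

      φ : ℕ → ℕ
      φ = orient reversed L

      tour-at : ∀ t → t ≤ L → ∀ {j} → φ t ≡ j → tour (suc t) ≡ pos (s + j)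
      tour-at t t≤L refl = tour-pos t t≤L

      pos-s+0 : pos (s + 0) ≡ pos s
      pos-s+0 = cong pos (+-identityʳ s)

      pos-s+suc : ∀ j → pos (s + suc j) ≡ pos (suc (s + j))
      pos-s+suc j = cong pos (+-suc s j)

      vertex⇒ : ∀ x → VS ⟦ W ⟧ x → x ≢ w → ∃[ j ] (j ≤ L × x ≡ pos (s + j))
      vertex⇒ x x∈W x≢w with VS⇒tour x x∈W
      ... | zero  , _               , refl = ⊥-elim (x≢w tour-0)
      ... | suc t , s≤s (s≤s t≤L) , refl = φ t , orient-≤ reversed t≤L , tour-pos t t≤L

      vertex⇐ : ∀ j → j ≤ L → VS ⟦ W ⟧ (pos (s + j))
      vertex⇐ j j≤L =
        subst (VS ⟦ W ⟧) (tour-at (φ j) (orient-≤ reversed j≤L) (orient-involutive reversed j≤L)) (tour-VS _)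

      edge⇐ : ∀ j → j < L → ES ⟦ W ⟧ (pos (s + j)) (pos (suc (s + j)))
      edge⇐ j j<L with orient-step⇐ reversed j<L
      ... | t , t<L , inj₁ (φt≡j , φ[1+t]≡1+j) =
        subst₂ (ES ⟦ W ⟧) (tour-at t (<⇒≤ t<L) φt≡j)
                          (trans (tour-at (suc t) t<L φ[1+t]≡1+j) (pos-s+suc j))
                          (tour-ES (suc t))
      ... | t , t<L , inj₂ (φ[1+t]≡j , φt≡1+j) = ES-sym {W}
        (subst₂ (ES ⟦ W ⟧) (trans (tour-at t (<⇒≤ t<L) φt≡1+j) (pos-s+suc j))
                           (tour-at (suc t) t<L φ[1+t]≡j)
                           (tour-ES (suc t)))

      tour-step : ∀ t → t < L →
                  ∃[ j ] (j < L × Joins (pos (s + j)) (pos (suc (s + j))) (tour (1 + t)) (tour (2 + t)))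
      tour-step t t<L with orient-suc reversed t<L
      ... | inj₁ φ[1+t]≡1+φt =
        φ t , subst (_≤ L) φ[1+t]≡1+φt (orient-≤ reversed t<L) ,
        inj₁ (sym (tour-pos t (<⇒≤ t<L)) ,
              sym (trans (tour-at (suc t) t<L φ[1+t]≡1+φt) (pos-s+suc (φ t))))
      ... | inj₂ φt≡1+φ[1+t] =
        φ (suc t) , subst (_≤ L) φt≡1+φ[1+t] (orient-≤ reversed (<⇒≤ t<L)) ,
        inj₂ (sym (tour-pos (suc t) t<L) ,
              sym (trans (tour-at t (<⇒≤ t<L) φt≡1+φ[1+t]) (pos-s+suc (φ (suc t)))))

      edge⇒ : ∀ x y → ES ⟦ W ⟧ x y → x ≢ w → y ≢ w →
              ∃[ j ] (j < L × Joins (pos (s + j)) (pos (suc (s + j))) x y)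
      edge⇒ x y xy∈W x≢w y≢w with ES⇒tour x y xy∈W
      ... | zero  , _ , j = ⊥-elim (proj₁ (Joins-≢ j x≢w y≢w) tour-0)
      ... | suc t , s≤s (s≤s t≤L) , j with m≤n⇒m<n∨m≡n t≤L
      ...   | inj₂ refl = ⊥-elim (proj₂ (Joins-≢ j x≢w y≢w) tour-closes)
      ...   | inj₁ t<L with tour-step t t<L
      ...     | i , i<L , j′ = i , i<L , Joins-trans j′ j

      to-first : ES ⟦ W ⟧ w (tour 1)
      to-first = subst (λ z → ES ⟦ W ⟧ z (tour 1)) tour-0 (tour-ES 0)

      to-last : ES ⟦ W ⟧ w (tour (suc L))
      to-last = ES-sym {W} (subst (ES ⟦ W ⟧ (tour (suc L))) tour-closes (tour-ES (suc L)))

      anchor-edges : ES ⟦ W ⟧ w (pos s) × ES ⟦ W ⟧ w (pos (s + L))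
      anchor-edges with orient-ends {L} reversed
      ... | inj₁ (φ0≡0 , φL≡L) = subst (ES ⟦ W ⟧ w) (trans (tour-at 0 z≤n φ0≡0) pos-s+0) to-first ,
                                 subst (ES ⟦ W ⟧ w) (tour-at L ≤-refl φL≡L) to-last
      ... | inj₂ (φ0≡L , φL≡0) = subst (ES ⟦ W ⟧ w) (trans (tour-at L ≤-refl φL≡0) pos-s+0) to-last ,
                                 subst (ES ⟦ W ⟧ w) (tour-at 0 z≤n φ0≡L) to-first

      ends-distinct : pos s ≢ pos (s + L)
      ends-distinct e =
        0≢1+n (≋-<⇒≡ z<s L<m (+-cancelˡ-≋ s (≋-trans (≡⇒≋ (+-identityʳ s)) (pos-injective e))))

      anchor-nbrs : ∀ x → VS ⟦ W ⟧ x → w ∼ x → x ≡ pos s ⊎ x ≡ pos (s + L)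
      anchor-nbrs x x∈W w∼x = one-of-two (λ z (z∈W , w∼z) → only-nbs z z∈W w∼z) ends-distinct
        (ES⇒VSʳ {W} (proj₁ anchor-edges) , ES⇒∼ {W} (proj₁ anchor-edges))
        (ES⇒VSʳ {W} (proj₂ anchor-edges) , ES⇒∼ {W} (proj₂ anchor-edges))
        (x∈W , w∼x)

      arc : Arc w W
      arc = record
        { s = s ; L = L ; L<m = L<m
        ; vertex⇒ = vertex⇒ ; vertex⇐ = vertex⇐ ; edge⇒ = edge⇒ ; edge⇐ = edge⇐
        ; first-edge = proj₁ anchor-edges ; last-edge = proj₂ anchor-edges ; anchor-nbrs = anchor-nbrs }

    arc : Arc w W
    arc = FromOrientation.arc oriented

  -- Barrier vertices

  InD-C : ∀ W {c} → InC c → ¬ VS ⟦ W ⟧ c → InD W c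
  InD-C W c∈C c∉W = c∉W , _ , c∈C , reach-refl {H = G-minus W} c∉W

  InD-nbr : ∀ W {c d} → InC c → ¬ VS ⟦ W ⟧ c → c ∼ d → ¬ VS ⟦ W ⟧ d → InD W d
  InD-nbr W c∈C c∉W c∼d d∉W =
    d∉W , _ , c∈C , reach-snoc {H = G-minus W} (reach-refl {H = G-minus W} c∉W) c∼d d∉W

  InD⇒¬CoTrivial : ∀ W {d} → InD W d → ¬ CoTrivial W
  InD⇒¬CoTrivial W (_ , c , c∈C , c⇝d) cotrivial = reach-source {H = G-minus W} c⇝d (cotrivial c c∈C)

  barrier-D : ∀ {w} W {a d} → InC a → InD W d → a ∼ d → Barrier w W a
  barrier-D W a∈C d∈D a∼d = inj₂ (InD⇒¬CoTrivial W d∈D , a∈C , _ , d∈D , a∼d)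

  I-exit-barrier : ∀ {w W a y c} → IsWedge w W → InI y → y ≢ w → InC a → a ∼ y →
                   InC c → ¬ VS ⟦ W ⟧ c → c ∼ y → Barrier w W a
  I-exit-barrier {W = W} wedge y∈I y≢w a∈C a∼y c∈C c∉W c∼y =
    barrier-D W a∈C (InD-nbr W c∈C c∉W c∼y (λ y∈W → y≢w (IsWedge.only-anchor wedge _ y∈W y∈I))) a∼y

  module ArcBarrier {w W} (w∈I : InI w) (A : Arc w W) where
    open Arc A

    beyond-arc : ∀ i → L < i → i < m → ¬ VS ⟦ W ⟧ (pos (s + i))
    beyond-arc i L<i i<m s+i∈W with vertex⇒ _ s+i∈W (InC⇒≢InI (pos-InC (s + i)) w∈I)
    ... | j , j≤L , s+i≡s+j = <⇒≱ L<i (subst (_≤ L) i≡j j≤L)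
      where
      i≡j : j ≡ i
      i≡j = sym (≋-<⇒≡ i<m (≤-<-trans j≤L L<m) (+-cancelˡ-≋ s (pos-injective s+i≡s+j)))

    full⇒CoTrivial : L ≡ m′ → CoTrivial W
    full⇒CoTrivial refl x x∈C with InC⇒pos x∈C
    ... | b , refl with offset b s
    ...   | r , s≤s r≤L , s+r≋b = subst (VS ⟦ W ⟧) (pos-cong s+r≋b) (vertex⇐ r r≤L)

    arc-end-barrier : ∀ {a} → a ≡ pos s ⊎ a ≡ pos (s + L) → Barrier w W a
    arc-end-barrier end with m≤n⇒m<n∨m≡n (s≤s⁻¹ L<m) | end
    ... | inj₂ L≡m′ | inj₁ refl = inj₁ (full⇒CoTrivial L≡m′ , first-edge)
    ... | inj₂ L≡m′ | inj₂ refl = inj₁ (full⇒CoTrivial L≡m′ , last-edge)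
    ... | inj₁ L<m′ | inj₁ refl =
      barrier-D W (pos-InC s) (InD-C W (pos-InC (s + m′)) (beyond-arc m′ L<m′ ≤-refl))
                  (∼-sym (pos-pred-adj s))
    ... | inj₁ L<m′ | inj₂ refl =
      barrier-D W (pos-InC (s + L)) (InD-C W (pos-InC (suc (s + L))) after-end∉W) (pos-adj (s + L))
      where
      after-end∉W : ¬ VS ⟦ W ⟧ (pos (suc (s + L)))
      after-end∉W = subst (λ p → ¬ VS ⟦ W ⟧ (pos p)) (+-suc s L) (beyond-arc (suc L) ≤-refl (s≤s L<m′))

    arc-vertex-exit : ∀ i {y} → i ≤ L → y ≡ pos (suc (s + i)) ⊎ y ≡ pos (s + i + m′) →
                      ¬ ES ⟦ W ⟧ (pos (s + i)) y → Barrier w W (pos (s + i))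
    arc-vertex-exit i i≤L (inj₁ refl) ¬edge with m≤n⇒m<n∨m≡n i≤L
    ... | inj₁ i<L  = ⊥-elim (¬edge (edge⇐ i i<L))
    ... | inj₂ refl = arc-end-barrier (inj₂ refl)
    arc-vertex-exit zero    _   (inj₂ _)    _     = arc-end-barrier (inj₁ (cong pos (+-identityʳ s)))
    arc-vertex-exit (suc i) i<L (inj₂ refl) ¬edge =
      ⊥-elim (¬edge (ES-sym {W} (subst₂ (ES ⟦ W ⟧) s+i≡y (cong pos (sym (+-suc s i))) (edge⇐ i i<L))))
      where
      s+i≡y : pos (s + i) ≡ pos (s + suc i + m′)
      s+i≡y = pos-cong (suc≋⇒≋+m′ (s + i) (s + suc i) (≡⇒≋ (sym (+-suc s i))))

    C-exit-barrier : ∀ {a y} → VS ⟦ W ⟧ a → InC a → InC y → a ∼ y → ¬ ES ⟦ W ⟧ a y →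
                     Barrier w W a
    C-exit-barrier {a} a∈W a∈C y∈C a∼y ay∉W with vertex⇒ a a∈W (InC⇒≢InI a∈C w∈I)
    ... | i , i≤L , refl = arc-vertex-exit i i≤L (C-nbr (s + i) y∈C a∼y) ay∉W

  record Segment (H : Subgraph G) (b lo hi : ℕ) : Set where
    field
      vertex : ∀ i → lo ≤ i → i ≤ hi → VS H (pos (b + i))
      edge   : ∀ i → lo ≤ i → i < hi → ES H (pos (b + i)) (pos (suc (b + i)))

  segment-∩ : ∀ {H K b lo hi} → Segment H b lo hi → Segment K b lo hi →
              Segment (_∩G_ G H K) b lo hi
  segment-∩ SH SK = record
    { vertex = λ i lo≤i i≤hi → Segment.vertex SH i lo≤i i≤hi , Segment.vertex SK i lo≤i i≤hi
    ; edge   = λ i lo≤i i<hi → Segment.edge SH i lo≤i i<hi , Segment.edge SK i lo≤i i<hi }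

  segment-C : ∀ b lo hi → Segment ⟦ C ⟧ b lo hi
  segment-C b lo hi = record { vertex = λ i _ _ → pos-InC (b + i) ; edge = λ i _ _ → pos-ES (b + i) }

  module _ {H b lo hi} (S : Segment H b lo hi) where
    open Segment S

    segment-reach-forward : ∀ {i} j → lo ≤ i → i ≤ j → j ≤ hi →
                            Reach G H (pos (b + i)) (pos (b + j))
    segment-reach-forward {i} j lo≤i i≤j j≤hi with m≤n⇒m<n∨m≡n i≤j
    segment-reach-forward j       lo≤i _ j≤hi | inj₂ refl = reach-refl {H = H} (vertex j lo≤i j≤hi)
    segment-reach-forward (suc j) lo≤i _ j<hi | inj₁ (s≤s i≤j) =
      reach-snoc {H = H} (segment-reach-forward j lo≤i i≤j (<⇒≤ j<hi))
                 (subst (λ p → ES H (pos (b + j)) (pos p)) (sym (+-suc b j)) (edge j lo≤j j<hi))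
                 (vertex (suc j) (≤-trans lo≤j (n≤1+n j)) j<hi)
      where
      lo≤j : lo ≤ j
      lo≤j = ≤-trans lo≤i i≤j

    segment-reach : (∀ {x y} → ES H x y → ES H y x) →
                    ∀ {i j} → lo ≤ i → i ≤ hi → lo ≤ j → j ≤ hi →
                    Reach G H (pos (b + i)) (pos (b + j))
    segment-reach ES-sym {i} {j} lo≤i i≤hi lo≤j j≤hi with ≤-total i j
    ... | inj₁ i≤j = segment-reach-forward j lo≤i i≤j j≤hi
    ... | inj₂ j≤i = reach-sym {H = H} ES-sym (segment-reach-forward i lo≤j j≤i i≤hi)

  module _ {y Wy} (Ay : Arc y Wy) where
    open Arc Ay

    C-nbr-in-complement : ∀ {c} → InC c → y ∼ c → ∃[ i ] (L ≤ i × i ≤ m × c ≡ pos (s + i))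
    C-nbr-in-complement c∈C y∼c with InC⇒pos c∈C
    ... | a , refl with offset a s
    ...   | i , i<m , s+i≋a with L ≤? i
    ...     | yes L≤i = i , L≤i , <⇒≤ i<m , pos-cong (≋-sym s+i≋a)
    ...     | no  L≰i with anchor-nbrs (pos (s + i)) (vertex⇐ i (<⇒≤ (≰⇒> L≰i)))
                                       (subst (y ∼_) (pos-cong (≋-sym s+i≋a)) y∼c)
    ...       | inj₁ e =
      m , <⇒≤ L<m , ≤-refl , trans (pos-cong (≋-sym s+i≋a)) (trans e (pos-cong (≋-sym (a+m≋a s))))
    ...       | inj₂ e = L , ≤-refl , <⇒≤ L<m , trans (pos-cong (≋-sym s+i≋a)) e

  -- Both ends of the arc of ω(y) are neighbours of y, so they lie on the arc of ω(u).  Either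
  -- the arc of ω(u) then wraps around the complementary arc, or it contains the arc of ω(y):
  -- properly, contradicting ¬ y ≺ u, or exactly, which forces N(y) ⊆ N(u).
  module Domination {y u Wy Wu} (y∈I : InI y) (u∈I : InI u) (Ay : Arc y Wy) (Au : Arc u Wu)
                    (N[y]⊈N[u] : ¬ (∀ z → y ∼ z → u ∼ z))
                    (N[y]⊆Wu : ∀ c → c ∼ y → VS ⟦ Wu ⟧ c)
                    (y⊀u : ¬ (_⊂G_ G (_─_ G ⟦ Wy ⟧ y) (_─_ G ⟦ Wu ⟧ u))) where
    module Y = Arc Ay
    module U = Arc Au

    pos≢u : ∀ a → pos a ≢ u
    pos≢u a = InC⇒≢InI (pos-InC a) u∈I

    nested⇒⊆ : ∀ c → Y.s ≋ U.s + c → c + Y.L ≤ U.L →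
               _⊆G_ G (_─_ G ⟦ Wy ⟧ y) (_─_ G ⟦ Wu ⟧ u)
    nested⇒⊆ c Y≋U+c c+L≤L = vertices , edges
      where
      shift : ∀ i → Y.s + i ≋ U.s + (c + i)
      shift i = ≋-trans (+-congʳ-≋ i Y≋U+c) (≡⇒≋ (+-assoc U.s c i))
      vertices : ∀ x → VS (_─_ G ⟦ Wy ⟧ y) x → VS (_─_ G ⟦ Wu ⟧ u) x
      vertices x (x∈Wy , x≢y) with Y.vertex⇒ x x∈Wy x≢y
      ... | i , i≤L , refl = subst (VS ⟦ Wu ⟧) (pos-cong (≋-sym (shift i)))
                                   (U.vertex⇐ (c + i) (≤-trans (+-monoʳ-≤ c i≤L) c+L≤L)) ,
                             pos≢u (Y.s + i)
      edge : ∀ i → i < Y.L → ES ⟦ Wu ⟧ (pos (Y.s + i)) (pos (suc (Y.s + i)))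
      edge i i<L = subst₂ (ES ⟦ Wu ⟧) (pos-cong (≋-sym (shift i)))
                          (pos-cong {suc (U.s + (c + i))} (≋-sym (+-congˡ-≋ 1 (shift i))))
                          (U.edge⇐ (c + i) (<-≤-trans (+-monoʳ-< c i<L) c+L≤L))
      edges : ∀ x x′ → ES (_─_ G ⟦ Wy ⟧ y) x x′ → ES (_─_ G ⟦ Wu ⟧ u) x x′
      edges x x′ (e , x≢y , x′≢y) with Y.edge⇒ x x′ e x≢y x′≢y
      ... | i , i<L , inj₁ (refl , refl) = edge i i<L , pos≢u (Y.s + i) , pos≢u (suc (Y.s + i))
      ... | i , i<L , inj₂ (refl , refl) =
        ES-sym {Wu} (edge i i<L) , pos≢u (suc (Y.s + i)) , pos≢u (Y.s + i)

    missed⇒⊉ : ∀ j → j ≤ U.L → (∀ i → i ≤ Y.L → ¬ (U.s + j ≋ Y.s + i)) →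
               ¬ (_⊆G_ G (_─_ G ⟦ Wu ⟧ u) (_─_ G ⟦ Wy ⟧ y))
    missed⇒⊉ j j≤L missed (vertices , _)
      with vertices (pos (U.s + j)) (U.vertex⇐ j j≤L , pos≢u (U.s + j))
    ... | p∈Wy , p≢y with Y.vertex⇒ _ p∈Wy p≢y
    ...   | i , i≤L , e = missed i i≤L (pos-injective e)

    strictly-nested⇒⊥ : ∀ c j → Y.s ≋ U.s + c → c + Y.L ≤ U.L → j ≤ U.L →
                        (∀ i → i ≤ Y.L → ¬ (U.s + j ≋ Y.s + i)) → ⊥
    strictly-nested⇒⊥ c j Y≋U+c c+L≤L j≤L missed =
      y⊀u (nested⇒⊆ c Y≋U+c c+L≤L , missed⇒⊉ j j≤L missed)

    module Offset (r : ℕ) (r<m : r < m) (Y+r≋U : Y.s + r ≋ U.s) where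

      on-Wu : ∀ i → VS ⟦ Wu ⟧ (pos (Y.s + i)) → ∃[ j ] (j ≤ U.L × i ≋ r + j)
      on-Wu i p∈Wu with U.vertex⇒ _ p∈Wu (pos≢u (Y.s + i))
      ... | j , j≤L , e = j , j≤L , +-cancelˡ-≋ Y.s (begin
        Y.s + i        ≈⟨ pos-injective e ⟩
        U.s + j        ≈⟨ +-congʳ-≋ j Y+r≋U ⟨
        Y.s + r + j    ≡⟨ +-assoc Y.s r j ⟩
        Y.s + (r + j)  ∎)
        where open ≋-Reasoning

      r+j<2m : ∀ j → j ≤ U.L → r + j < m + m
      r+j<2m j j≤L = +-mono-<-≤ r<m (≤-trans j≤L (<⇒≤ U.L<m))

      start-on-Wu : ∃[ j ] (j ≤ U.L × (r + j ≡ 0 ⊎ r + j ≡ m))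
      start-on-Wu with on-Wu 0 (subst (λ p → VS ⟦ Wu ⟧ (pos p)) (sym (+-identityʳ Y.s))
                                      (N[y]⊆Wu _ (∼-sym (ES⇒∼ {Wy} Y.first-edge))))
      ... | j , j≤L , 0≋r+j = j , j≤L , ≋-<2m (r+j<2m j j≤L) z<s (≋-sym 0≋r+j)

      end-on-Wu : ∃[ j ] (j ≤ U.L × (r + j ≡ Y.L ⊎ r + j ≡ Y.L + m))
      end-on-Wu with on-Wu Y.L (N[y]⊆Wu _ (∼-sym (ES⇒∼ {Wy} Y.last-edge)))
      ... | j , j≤L , L≋r+j = j , j≤L , ≋-<2m (r+j<2m j j≤L) Y.L<m (≋-sym L≋r+j)

      module Aligned (r≡0 : r ≡ 0) where

        shift : ∀ i → Y.s + i ≋ U.s + i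
        shift i = +-congʳ-≋ i (≋-trans (≡⇒≋ (sym (trans (cong (Y.s +_) r≡0) (+-identityʳ Y.s)))) Y+r≋U)

        shorter⇒⊥ : Y.L < U.L → ⊥
        shorter⇒⊥ YL<UL =
          strictly-nested⇒⊥ 0 U.L (≋-trans (≡⇒≋ (sym (+-identityʳ Y.s))) (shift 0)) (<⇒≤ YL<UL)
                            ≤-refl missed
          where
          missed : ∀ i → i ≤ Y.L → ¬ (U.s + U.L ≋ Y.s + i)
          missed i i≤L e = <⇒≱ YL<UL (subst (_≤ Y.L) (sym UL≡i) i≤L)
            where
            UL≡i : U.L ≡ i
            UL≡i = ≋-<⇒≡ U.L<m (≤-<-trans i≤L Y.L<m) (+-cancelˡ-≋ U.s (≋-trans e (shift i)))

        same⇒⊥ : Y.L ≡ U.L → ⊥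
        same⇒⊥ YL≡UL = N[y]⊈N[u] N[y]⊆N[u]
          where
          first : pos Y.s ≡ pos U.s
          first = trans (cong pos (sym (+-identityʳ Y.s))) (trans (pos-cong (shift 0)) (cong pos (+-identityʳ U.s)))
          last : pos (Y.s + Y.L) ≡ pos (U.s + U.L)
          last = trans (cong (λ l → pos (Y.s + l)) YL≡UL) (pos-cong (shift U.L))
          N[y]⊆N[u] : ∀ z → y ∼ z → u ∼ z
          N[y]⊆N[u] z y∼z
            with U.vertex⇒ z (N[y]⊆Wu z (∼-sym y∼z)) (InC⇒≢InI (I-nbr⇒InC y∈I (∼-sym y∼z)) u∈I)
          ... | j , j≤L , refl
            with Y.anchor-nbrs (pos (Y.s + j)) (Y.vertex⇐ j (subst (j ≤_) (sym YL≡UL) j≤L))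
                               (subst (y ∼_) (pos-cong (≋-sym (shift j))) y∼z)
          ...   | inj₁ e = subst (u ∼_) (sym (trans (pos-cong (≋-sym (shift j))) (trans e first)))
                                 (ES⇒∼ {Wu} U.first-edge)
          ...   | inj₂ e = subst (u ∼_) (sym (trans (pos-cong (≋-sym (shift j))) (trans e last)))
                                 (ES⇒∼ {Wu} U.last-edge)

        impossible : ⊥
        impossible with end-on-Wu
        ... | j , j≤L , inj₂ r+j≡L+m = <⇒≱ (≤-<-trans j≤L U.L<m)
                                          (subst (m ≤_) (trans (sym r+j≡L+m) (cong (_+ j) r≡0)) (m≤n+m m Y.L))
        ... | j , j≤L , inj₁ r+j≡L
          with m≤n⇒m<n∨m≡n (subst (_≤ U.L) (trans (sym (cong (_+ j) r≡0)) r+j≡L) j≤L)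
        ...   | inj₁ YL<UL = shorter⇒⊥ YL<UL
        ...   | inj₂ YL≡UL = same⇒⊥ YL≡UL

      module Wrapped (j₀ : ℕ) (j₀≤L : j₀ ≤ U.L) (r+j₀≡m : r + j₀ ≡ m) where

        m≤r+UL : m ≤ r + U.L
        m≤r+UL = subst (_≤ r + U.L) r+j₀≡m (+-monoʳ-≤ r j₀≤L)

        covered : ∀ j₁ → r + j₁ ≡ Y.L → Segment ⟦ Wu ⟧ Y.s Y.L m
        covered j₁ r+j₁≡L = record { vertex = vertex ; edge = edge }
          where
          r≤L : r ≤ Y.L
          r≤L = subst (r ≤_) r+j₁≡L (m≤m+n r j₁)
          r+[i∸r]≡i : ∀ {i} → Y.L ≤ i → r + (i ∸ r) ≡ i
          r+[i∸r]≡i L≤i = m+[n∸m]≡n (≤-trans r≤L L≤i)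
          rebase : ∀ {i} → Y.L ≤ i → Y.s + i ≋ U.s + (i ∸ r)
          rebase {i} L≤i = begin
            Y.s + i              ≡⟨ cong (Y.s +_) (r+[i∸r]≡i L≤i) ⟨
            Y.s + (r + (i ∸ r))  ≡⟨ +-assoc Y.s r (i ∸ r) ⟨
            Y.s + r + (i ∸ r)    ≈⟨ +-congʳ-≋ (i ∸ r) Y+r≋U ⟩
            U.s + (i ∸ r)        ∎
            where open ≋-Reasoning
          vertex : ∀ i → Y.L ≤ i → i ≤ m → VS ⟦ Wu ⟧ (pos (Y.s + i))
          vertex i L≤i i≤m =
            subst (VS ⟦ Wu ⟧) (pos-cong (≋-sym (rebase L≤i))) (U.vertex⇐ (i ∸ r) i∸r≤L)
            where
            i∸r≤L : i ∸ r ≤ U.L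
            i∸r≤L = +-cancelˡ-≤ r _ _
                      (subst (_≤ r + U.L) (sym (r+[i∸r]≡i L≤i)) (≤-trans i≤m m≤r+UL))
          edge : ∀ i → Y.L ≤ i → i < m → ES ⟦ Wu ⟧ (pos (Y.s + i)) (pos (suc (Y.s + i)))
          edge i L≤i i<m = subst₂ (ES ⟦ Wu ⟧) (pos-cong (≋-sym (rebase L≤i)))
                                  (pos-cong {suc (U.s + (i ∸ r))} (≋-sym (+-congˡ-≋ 1 (rebase L≤i))))
                                  (U.edge⇐ (i ∸ r) i∸r<L)
            where
            i∸r<L : i ∸ r < U.L
            i∸r<L = +-cancelˡ-< r _ _
                      (subst (_< r + U.L) (sym (r+[i∸r]≡i L≤i)) (<-≤-trans i<m m≤r+UL))

        overlapping⇒⊥ : ∀ j₁ → j₁ ≤ U.L → r + j₁ ≡ Y.L + m → ⊥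
        overlapping⇒⊥ j₁ j₁≤L r+j₁≡L+m =
          strictly-nested⇒⊥ c 0 Y≋U+c (subst (_≤ U.L) (sym c+L≡j₁) j₁≤L) z≤n missed
          where
          c : ℕ
          c = m ∸ r
          r+c≡m : r + c ≡ m
          r+c≡m = m+[n∸m]≡n (<⇒≤ r<m)
          Y≋U+c : Y.s ≋ U.s + c
          Y≋U+c = begin
            Y.s            ≈⟨ a+m≋a Y.s ⟨
            Y.s + m        ≡⟨ cong (Y.s +_) r+c≡m ⟨
            Y.s + (r + c)  ≡⟨ +-assoc Y.s r c ⟨
            Y.s + r + c    ≈⟨ +-congʳ-≋ c Y+r≋U ⟩
            U.s + c        ∎
            where open ≋-Reasoning
          c+L≡j₁ : c + Y.L ≡ j₁
          c+L≡j₁ = +-cancelˡ-≡ r _ _ (trans (sym (+-assoc r c Y.L))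
                                     (trans (cong (_+ Y.L) r+c≡m) (trans (+-comm m Y.L) (sym r+j₁≡L+m))))
          L<r : Y.L < r
          L<r = +-cancelʳ-< m Y.L r (subst (_< r + m) r+j₁≡L+m (+-monoʳ-< r (≤-<-trans j₁≤L U.L<m)))
          missed : ∀ i → i ≤ Y.L → ¬ (U.s + 0 ≋ Y.s + i)
          missed i i≤L e = <⇒≱ L<r (subst (_≤ Y.L) (sym r≡i) i≤L)
            where
            r≡i : r ≡ i
            r≡i = ≋-<⇒≡ r<m (≤-<-trans i≤L Y.L<m)
                        (+-cancelˡ-≋ Y.s (≋-trans Y+r≋U (≋-trans (≡⇒≋ (sym (+-identityʳ U.s))) e)))

        covered-complement : Segment ⟦ Wu ⟧ Y.s Y.L m
        covered-complement with end-on-Wu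
        ... | j₁ , _    , inj₁ r+j₁≡L   = covered j₁ r+j₁≡L
        ... | j₁ , j₁≤L , inj₂ r+j₁≡L+m = ⊥-elim (overlapping⇒⊥ j₁ j₁≤L r+j₁≡L+m)

      covered-complement : Segment ⟦ Wu ⟧ Y.s Y.L m
      covered-complement with start-on-Wu
      ... | _  , _    , inj₁ r+j₀≡0 = ⊥-elim (Aligned.impossible (m+n≡0⇒m≡0 r r+j₀≡0))
      ... | j₀ , j₀≤L , inj₂ r+j₀≡m = Wrapped.covered-complement j₀ j₀≤L r+j₀≡m

    covered-complement : Segment ⟦ Wu ⟧ Y.s Y.L m
    covered-complement with offset U.s Y.s
    ... | r , r<m , Y+r≋U = Offset.covered-complement r r<m Y+r≋U

  -- Separation

  module Separation (Ω : WedgeSelection) (arcs : ∀ y → InI y → Arc y (WedgeSelection.ω Ω y))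
                    {u v} (u-good : Good Ω u) (v-good : Good Ω v) (x : V G) where
    open WedgeSelection Ω

    H : Subgraph G
    H = _∩G_ G (_∩G_ G ⟦ ω u ⟧ ⟦ ω v ⟧) ⟦ C ⟧

    Barrier₂ : V G → Set
    Barrier₂ a = Barrier u (ω u) a ⊎ Barrier v (ω v) a

    u∈I : InI u
    u∈I = proj₁ u-good

    v∈I : InI v
    v∈I = proj₁ v-good

    module ∂u = ArcBarrier u∈I (arcs u u∈I)
    module ∂v = ArcBarrier v∈I (arcs v v∈I)

    H-sym : ∀ {p q} → ES H p q → ES H q p
    H-sym ((pq∈ωu , pq∈ωv) , pq∈C) = (ES-sym {ω u} pq∈ωu , ES-sym {ω v} pq∈ωv) , ES-sym {C} pq∈C

    complement-in-H : ∀ {y} (y∈I : InI y) → y ≢ u → y ≢ v →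
                      (∀ c → c ∼ y → VS ⟦ ω u ⟧ c) → (∀ c → c ∼ y → VS ⟦ ω v ⟧ c) →
                      Segment H (Arc.s (arcs y y∈I)) (Arc.L (arcs y y∈I)) m
    complement-in-H {y} y∈I y≢u y≢v N[y]⊆ωu N[y]⊆ωv =
      segment-∩ (segment-∩ (dominated u-good y≢u N[y]⊆ωu) (dominated v-good y≢v N[y]⊆ωv))
                (segment-C _ _ _)
      where
      dominated : ∀ {w} → Good Ω w → y ≢ w → (∀ c → c ∼ y → VS ⟦ ω w ⟧ c) →
                  Segment ⟦ ω w ⟧ (Arc.s (arcs y y∈I)) (Arc.L (arcs y y∈I)) m
      dominated {w} (w∈I , w-minimal) y≢w N[y]⊆ωw =
        Domination.covered-complement y∈I w∈I (arcs y y∈I) (arcs w w∈I) (nbhd-incomp y w y∈I w∈I y≢w)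
                                      N[y]⊆ωw (λ y≺w → w-minimal (y , y∈I , y≺w))

    around : ∀ {y a z} (y∈I : InI y) → y ≢ u → y ≢ v →
             (∀ c → c ∼ y → VS ⟦ ω u ⟧ c) → (∀ c → c ∼ y → VS ⟦ ω v ⟧ c) →
             InC a → a ∼ y → InC z → y ∼ z → Reach G H a z
    around y∈I y≢u y≢v N[y]⊆ωu N[y]⊆ωv a∈C a∼y z∈C y∼z
      with C-nbr-in-complement (arcs _ y∈I) a∈C (∼-sym a∼y)
         | C-nbr-in-complement (arcs _ y∈I) z∈C y∼z
    ... | i , L≤i , i≤m , refl | j , L≤j , j≤m , refl =
      segment-reach (complement-in-H y∈I y≢u y≢v N[y]⊆ωu N[y]⊆ωv) H-sym L≤i i≤m L≤j j≤m

    C-step : ∀ {a y} → Reach G H x a → InC y → a ∼ y → Reach G H x y ⊎ Barrier₂ a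
    C-step {a} {y} x⇝a y∈C a∼y with reach-target {H = H} x⇝a | ES? (ω u) a y | ES? (ω v) a y
    ... | _ , a∈C | yes ay∈ωu | yes ay∈ωv =
      inj₁ (reach-snoc {H = H} x⇝a ((ay∈ωu , ay∈ωv) , induced a y a∈C y∈C a∼y)
                                  ((ES⇒VSʳ {ω u} ay∈ωu , ES⇒VSʳ {ω v} ay∈ωv) , y∈C))
    ... | (a∈ωu , _) , a∈C | no ay∉ωu | _ =
      inj₂ (inj₁ (∂u.C-exit-barrier a∈ωu a∈C y∈C a∼y ay∉ωu))
    ... | (_ , a∈ωv) , a∈C | yes _ | no ay∉ωv =
      inj₂ (inj₂ (∂v.C-exit-barrier a∈ωv a∈C y∈C a∼y ay∉ωv))

    I-step : ∀ {a y z} → Reach G H x a → InI y → a ∼ y → y ∼ z → InC z →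
             Reach G H x z ⊎ Barrier₂ a
    I-step {a} {y} x⇝a y∈I a∼y y∼z z∈C with reach-target {H = H} x⇝a
    ... | (a∈ωu , a∈ωv) , a∈C with y Fin.≟ u | y Fin.≟ v
    ...   | yes refl | _ =
      inj₂ (inj₁ (∂u.arc-end-barrier (Arc.anchor-nbrs (arcs u u∈I) a a∈ωu (∼-sym a∼y))))
    ...   | no _ | yes refl =
      inj₂ (inj₂ (∂v.arc-end-barrier (Arc.anchor-nbrs (arcs v v∈I) a a∈ωv (∼-sym a∼y))))
    ...   | no y≢u | no y≢v with nbrs-inside-or-escape (ω u) y | nbrs-inside-or-escape (ω v) y
    ...     | inj₂ (c , c∼y , c∉ωu) | _ =
      inj₂ (inj₁ (I-exit-barrier (ω-wedge u u∈I) y∈I y≢u a∈C a∼y (I-nbr⇒InC y∈I c∼y) c∉ωu c∼y))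
    ...     | inj₁ _ | inj₂ (c , c∼y , c∉ωv) =
      inj₂ (inj₂ (I-exit-barrier (ω-wedge v v∈I) y∈I y≢v a∈C a∼y (I-nbr⇒InC y∈I c∼y) c∉ωv c∼y))
    ...     | inj₁ N[y]⊆ωu | inj₁ N[y]⊆ωv =
      inj₁ (reach-trans {H = H} x⇝a (around y∈I y≢u y≢v N[y]⊆ωu N[y]⊆ωv a∈C a∼y z∈C y∼z))

    separate : ∀ {a b ps} → Reach G H x a → InC b → ¬ Reach G H x b → Walk _∼_ a b ps →
               Any Barrier₂ ps
    separate x⇝a b∈C x⇏b [ _ ] = ⊥-elim (x⇏b x⇝a)
    separate x⇝a b∈C x⇏b (_∷_ {y = y} a∼y walk) with InC? y
    ... | yes y∈C with C-step x⇝a y∈C a∼y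
    ...   | inj₁ x⇝y = there (separate x⇝y b∈C x⇏b walk)
    ...   | inj₂ a∈∂ = here a∈∂
    separate x⇝a b∈C x⇏b (a∼y ∷ [ _ ]) | no y∉C = ⊥-elim (y∉C b∈C)
    separate x⇝a b∈C x⇏b (a∼y ∷ (y∼z ∷ walk)) | no y∉C
      with I-step x⇝a y∉C a∼y y∼z (I-nbr⇒InC y∉C (∼-sym y∼z))
    ... | inj₁ x⇝z = there (there (separate x⇝z b∈C x⇏b walk))
    ... | inj₂ a∈∂ = here a∈∂

lemma4p4 : (G : Graph) (C : Cycle G) → Presentation.IsCobweb G C →
    (Ω : Presentation.WedgeSelection G C) → ∀ u v →
    let open Presentation G C
        open WedgeSelection Ω
        H = _∩G_ G (_∩G_ G (⟪_⟫ G (ω u)) (⟪_⟫ G (ω v))) (⟪_⟫ G C)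
    in Good Ω u → Good Ω v →
       ∀ x → VS H x →
       Separates G (λ y → Barrier u (ω u) y ⊎ Barrier v (ω v) y)
                   (Reach G H x)
                   (λ y → InC y × ¬ Reach G H x y)
lemma4p4 G C cob Ω u v u-good v-good x _ a b ps x⇝a (b∈C , x⇏b) walk _ =
  Separation.separate Ω arcs u-good v-good x x⇝a b∈C x⇏b walk
  where
  open Cobweb G C cob
  arcs : ∀ y → Presentation.InI G C y → Arc y (Presentation.WedgeSelection.ω Ω y)
  arcs y y∈I = WedgeArc.arc (Presentation.WedgeSelection.ω-wedge Ω y y∈I)
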